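{- Let $G=(V,E)$ be an undirected graph and $S\subseteq V$. A subset $R\subseteq V$ is an $S$-strong region if and only if for every $S^*\subseteq V$ such that $S\cup S^*$ power dominates $G$, we have $R\cap(S^*\setminus S)\neq\emptyset$.
   Context: For an undirected graph $G=(V,E)$ and $S\subseteq V$, $\mathcal{P}_S$ is obtained by (Rule 1) putting every node of $S$ and every neighbor of a node of $S$ into $\mathcal{P}_S$, and (Rule 2) repeatedly: if $v\in\mathcal{P}_S$ and all neighbors of $v$ except exactly one neighbor $w$ are in $\mathcal{P}_S$, insert $w$. $S$ power dominates $G$ if $\mathcal{P}_S=V$. For $R\subseteq V$, $nbr(R)=\{v\in V\setminus R: v \text{ is adjacent to some } u\in R\}$. A set $R\subseteq V$ is an $S$-strong region if $R\not\subseteq\mathcal{P}_{S\cup nbr(R)}$; otherwise $R$ is an $S$-weak region. -}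

module Defs where

open import Data.Nat using (ℕ)
open import Data.Fin using (Fin)
open import Data.Bool using (Bool; true; false; not; _∧_; _∨_)
open import Data.Vec using (tabulate; lookup)
open import Data.Fin.Subset using (Subset; _∈_; _∉_; _⊆_; _∪_)
open import Relation.Binary.PropositionalEquality using (_≡_; _≢_)
open import Relation.Nullary using (¬_)

record Graph (n : ℕ) : Set where
  field
    adj   : Fin n → Fin n → Bool
    sym   : ∀ u v → adj u v ≡ adj v u
    irrefl : ∀ v → adj v v ≡ false

open Graph public

Adj : ∀ {n} → Graph n → Fin n → Fin n → Set
Adj G u v = adj G u v ≡ true

anyFin : ∀ {n} → (Fin n → Bool) → Bool
anyFin {ℕ.zero}  f = false
anyFin {ℕ.suc n} f = f Fin.zero ∨ anyFin {n} (λ i → f (Fin.suc i))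

nbr : ∀ {n} → Graph n → Subset n → Subset n
nbr G R = tabulate (λ v → not (lookup R v) ∧ anyFin (λ u → lookup R u ∧ adj G u v))

-- The power-domination closure P_S: the least set closed under
-- Rule 1 (S and its neighbours) and Rule 2 (zero forcing).
data InP {n} (G : Graph n) (S : Subset n) : Fin n → Set where
  rule1-self : ∀ {v} → v ∈ S → InP G S v
  rule1-nbr  : ∀ {u v} → u ∈ S → Adj G u v → InP G S v
  rule2      : ∀ {v w} → InP G S v → Adj G v w →
               (∀ x → Adj G v x → x ≢ w → InP G S x) → InP G S w

PowerDominates : ∀ {n} → Graph n → Subset n → Set
PowerDominates G S = ∀ v → InP G S v

SubsetP : ∀ {n} → Graph n → Subset n → Subset n → Set
SubsetP G S R = ∀ v → v ∈ R → InP G S v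

Strong : ∀ {n} → Graph n → Subset n → Subset n → Set
Strong G S R = ¬ SubsetP G (S ∪ nbr G R) R

Weak : ∀ {n} → Graph n → Subset n → Subset n → Set
Weak G S R = SubsetP G (S ∪ nbr G R) R

-- Vertices of R can only be forced from inside R or from nbr(R), so a power
-- dominating set S ∪ S* that adds nothing new inside R already forces all of R
-- from S ∪ nbr(R): a strong region must be hit. Conversely, if R is weak then
-- S* = ∁ R completes S to a power dominating set while missing R entirely.
module Submission where

open import Defs
open import Data.Nat using (ℕ)
open import Data.Bool using (Bool; true; false; not; _∧_; _∨_)
open import Data.Bool.Properties using (∨-zeroʳ)
open import Data.Fin using (Fin; zero; suc)
open import Data.Fin.Subset using (Subset; _∈_; _∉_; _⊆_; _∪_; _∩_; _─_; ∁; Nonempty; Empty)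
open import Data.Fin.Subset.Properties
  using (_∈?_; nonempty?; p⊆p∪q; q⊆p∪q; x∈p∪q⁺; x∈p∪q⁻; x∈p∩q⁺; p∩q⊆p; p∩q⊆q;
         x∈p∧x∉q⇒x∈p─q; p─q⊆p; x∉p⇒x∈∁p; x∈∁p⇒x∉p)
open import Data.Empty using (⊥)
open import Data.Product using (_×_; _,_)
open import Data.Sum using (inj₁; inj₂; map₂)
open import Data.Vec using (lookup)
open import Data.Vec.Properties using ([]=⇒lookup; lookup⇒[]=; lookup∘tabulate)
open import Function using (_∘_)
open import Relation.Nullary using (yes; no; contradiction)
open import Relation.Binary.PropositionalEquality as ≡ using (_≡_; _≢_; refl; trans; cong; cong₂)

private
  variable
    n : ℕ
    G : Graph n
    R S S′ T : Subset n
    u v x : Fin n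

Adj-sym : (G : Graph n) → Adj G u v → Adj G v u
Adj-sym G uv = trans (Graph.sym G _ _) uv

anyFin-witness : (f : Fin n → Bool) (u : Fin n) → f u ≡ true → anyFin f ≡ true
anyFin-witness f zero    fu = cong (_∨ anyFin (f ∘ suc)) fu
anyFin-witness f (suc u) fu =
  trans (cong (f zero ∨_) (anyFin-witness (f ∘ suc) u fu)) (∨-zeroʳ (f zero))

∉⇒lookup≡false : v ∉ R → lookup R v ≡ false
∉⇒lookup≡false {v = v} {R} v∉R with lookup R v in eq
... | true  = contradiction (lookup⇒[]= v R eq) v∉R
... | false = refl

∈-nbr : (G : Graph n) → u ∈ R → v ∉ R → Adj G u v → v ∈ nbr G R
∈-nbr {u = u} {R} {v} G u∈R v∉R uv = lookup⇒[]= v (nbr G R) (trans (lookup∘tabulate _ v)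
  (cong₂ _∧_ (cong not (∉⇒lookup≡false v∉R))
             (anyFin-witness (λ w → lookup R w ∧ adj G w v) u
                             (cong₂ _∧_ ([]=⇒lookup u∈R) uv))))

nbr⊆∁ : (G : Graph n) → nbr G R ⊆ ∁ R
nbr⊆∁ {R = R} G {v} v∈nbr = x∉p⇒x∈∁p absurd
  where
  absurd : v ∈ R → ⊥
  absurd v∈R with lookup R v | []=⇒lookup v∈R
                | trans (≡.sym (lookup∘tabulate _ v)) ([]=⇒lookup v∈nbr)
  ... | .true | refl | ()

InP-mono : S ⊆ T → InP G S v → InP G T v
InP-mono S⊆T (rule1-self v∈S)    = rule1-self (S⊆T v∈S)
InP-mono S⊆T (rule1-nbr u∈S uv)  = rule1-nbr (S⊆T u∈S) uv
InP-mono S⊆T (rule2 v∈P vw rest) =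
  rule2 (InP-mono S⊆T v∈P) vw (λ x vx x≢w → InP-mono S⊆T (rest x vx x≢w))

InP-region : (∀ {x} → x ∈ R → x ∈ S′ → x ∈ S) →
             InP G S′ v → v ∈ R → InP G (S ∪ nbr G R) v
InP-region {R = R} {S′} {S} {G} R∩S′⊆S = go
  where
  seed : x ∈ R → x ∈ S′ → x ∈ S ∪ nbr G R
  seed x∈R x∈S′ = p⊆p∪q (nbr G R) (R∩S′⊆S x∈R x∈S′)

  outer : u ∈ R → v ∉ R → Adj G u v → v ∈ S ∪ nbr G R
  outer u∈R v∉R uv = q⊆p∪q S (nbr G R) (∈-nbr G u∈R v∉R uv)

  observed-from-outside : u ∉ R → v ∈ R → Adj G u v → InP G (S ∪ nbr G R) v
  observed-from-outside u∉R v∈R uv = rule1-nbr (outer v∈R u∉R (Adj-sym G uv)) uv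

  go : InP G S′ v → v ∈ R → InP G (S ∪ nbr G R) v
  go (rule1-self v∈S′) v∈R = rule1-self (seed v∈R v∈S′)
  go (rule1-nbr {u} u∈S′ uv) v∈R with u ∈? R
  ... | yes u∈R = rule1-nbr (seed u∈R u∈S′) uv
  ... | no  u∉R = observed-from-outside u∉R v∈R uv
  go (rule2 {v} {w} v∈P vw rest) w∈R with v ∈? R
  ... | no  v∉R = observed-from-outside v∉R w∈R vw
  ... | yes v∈R = rule2 (go v∈P v∈R) vw forced
    where
    forced : ∀ x → Adj G v x → x ≢ w → InP G (S ∪ nbr G R) x
    forced x vx x≢w with x ∈? R
    ... | yes x∈R = go (rest x vx x≢w) x∈R
    ... | no  x∉R = rule1-self (outer v∈R x∉R vx)

Empty[R∩T─S]⇒R∩[S∪T]⊆S : Empty (R ∩ (T ─ S)) → x ∈ R → x ∈ S ∪ T → x ∈ S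
Empty[R∩T─S]⇒R∩[S∪T]⊆S {T = T} {S} {x} empty x∈R x∈S∪T with x ∈? S | x∈p∪q⁻ S T x∈S∪T
... | yes x∈S | _        = x∈S
... | no  _   | inj₁ x∈S = x∈S
... | no  x∉S | inj₂ x∈T = contradiction (x , x∈p∩q⁺ (x∈R , x∈p∧x∉q⇒x∈p─q x∈T x∉S)) empty

Strong⇒hits : Strong G S R → PowerDominates G (S ∪ T) → Nonempty (R ∩ (T ─ S))
Strong⇒hits {S = S} {R} {T} strong dom with nonempty? (R ∩ (T ─ S))
... | yes hit  = hit
... | no  miss =
  contradiction (λ v v∈R → InP-region (Empty[R∩T─S]⇒R∩[S∪T]⊆S miss) (dom v) v∈R) strong

Weak⇒S∪∁R-dominates : Weak G S R → PowerDominates G (S ∪ ∁ R)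
Weak⇒S∪∁R-dominates {G = G} {S} {R} weak v with v ∈? R
... | yes v∈R = InP-mono (x∈p∪q⁺ ∘ map₂ (nbr⊆∁ G) ∘ x∈p∪q⁻ S (nbr G R)) (weak v v∈R)
... | no  v∉R = rule1-self (q⊆p∪q S (∁ R) (x∉p⇒x∈∁p v∉R))

lemma2 : ∀ {n} (G : Graph n) (S R : Subset n) →
    (Strong G S R →
      ∀ (S* : Subset n) → PowerDominates G (S ∪ S*) → Nonempty (R ∩ (S* ─ S)))
    × ((∀ (S* : Subset n) → PowerDominates G (S ∪ S*) → Nonempty (R ∩ (S* ─ S)))
      → Strong G S R)
lemma2 G S R = (λ strong S* → Strong⇒hits strong) , hits⇒Strong
  where
  hits⇒Strong : (∀ S* → PowerDominates G (S ∪ S*) → Nonempty (R ∩ (S* ─ S))) → Strong G S R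
  hits⇒Strong hits weak with hits (∁ R) (Weak⇒S∪∁R-dominates weak)
  ... | x , x∈R∩∁R─S =
    x∈∁p⇒x∉p (p─q⊆p (∁ R) S (p∩q⊆q R _ x∈R∩∁R─S)) (p∩q⊆p R _ x∈R∩∁R─S)
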